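{- For any star $S$ and any $n$-vertex tree $T$, $$\mathrm{gm}(S\mathbin{\Box} T) \leq \mathrm{gm}(S \boxtimes T) \leq \mathrm{gm}(S\cdot T) <\sqrt{3n+1}+1.$$
   Context: For a graph $G$, $\mathrm{gm}(G)$ is the maximum integer $k$ such that the $k\times k$ grid is a minor of $G$. $G_1\mathbin{\Box} G_2$ is the Cartesian product, $G_1\boxtimes G_2$ the strong product, and $G_1\cdot G_2$ denotes the lexicographic product: vertex set $V(G_1)\times V(G_2)$, where distinct $(u_1,u_2),(v_1,v_2)$ are adjacent iff $u_1v_1\in E(G_1)$, or $u_1=v_1$ and $u_2v_2\in E(G_2)$. -}

module Defs where

open import Data.Nat using (ℕ; zero; suc; _+_; _^_; _∸_; _<_; _≤_)
open import Data.Fin using (Fin; zero; suc; toℕ; inject₁; fromℕ)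
open import Data.Product using (Σ; ∃; _×_; _,_)
open import Data.Sum using (_⊎_)
open import Data.Unit using (⊤)
open import Relation.Nullary using (¬_)
open import Relation.Binary.PropositionalEquality using (_≡_; _≢_)
open import Function.Definitions using (Injective)

record Graph : Set₁ where
  field
    V : Set
    E : V → V → Set
open Graph public

data WalkIn (G : Graph) (P : V G → Set) : V G → V G → Set where
  here : ∀ {u} → P u → WalkIn G P u u
  step : ∀ {u w v} → P u → E G u w → WalkIn G P w v → WalkIn G P u v

record MinorModel (H G : Graph) : Set₁ where
  field
    branch    : V H → V G → Set
    nonempty  : ∀ h → ∃ λ v → branch h v
    disjoint  : ∀ h h' v → branch h v → branch h' v → h ≡ h'
    connected : ∀ h u v → branch h u → branch h v → WalkIn G (branch h) u v
    edges     : ∀ h h' → E H h h' →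
                ∃ λ u → ∃ λ v → branch h u × branch h' v × E G u v

_≼_ : Graph → Graph → Set₁
H ≼ G = MinorModel H G

Adj1 : ∀ {k} → Fin k → Fin k → Set
Adj1 i j = toℕ j ≡ suc (toℕ i) ⊎ toℕ i ≡ suc (toℕ j)

Grid : ℕ → Graph
Grid k = record
  { V = Fin k × Fin k
  ; E = λ { (a , b) (c , d) → (a ≡ c × Adj1 b d) ⊎ (b ≡ d × Adj1 a c) } }

IsGM : Graph → ℕ → Set₁
IsGM G k = (Grid k ≼ G) × (∀ j → Grid j ≼ G → j ≤ k)

_□_ : Graph → Graph → Graph
G □ H = record
  { V = V G × V H
  ; E = λ { (u₁ , u₂) (v₁ , v₂) → (u₁ ≡ v₁ × E H u₂ v₂) ⊎ (u₂ ≡ v₂ × E G u₁ v₁) } }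

_⊠_ : Graph → Graph → Graph
G ⊠ H = record
  { V = V G × V H
  ; E = λ { (u₁ , u₂) (v₁ , v₂) →
        ((u₁ ≡ v₁ ⊎ E G u₁ v₁) × (u₂ ≡ v₂ ⊎ E H u₂ v₂))
        × ¬ ((u₁ , u₂) ≡ (v₁ , v₂)) } }

_·_ : Graph → Graph → Graph
G · H = record
  { V = V G × V H
  ; E = λ { (u₁ , u₂) (v₁ , v₂) → E G u₁ v₁ ⊎ (u₁ ≡ v₁ × E H u₂ v₂) } }

Star : ℕ → Graph
Star m = record
  { V = Fin (suc m)
  ; E = λ u v → (u ≡ zero × v ≢ zero) ⊎ (v ≡ zero × u ≢ zero) }

FinGraph : (n : ℕ) → (Fin n → Fin n → Set) → Graph
FinGraph n R = record { V = Fin n ; E = R }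

IsSimple : (G : Graph) → Set
IsSimple G = (∀ u v → E G u v → E G v u) × (∀ u → ¬ E G u u)

Connected : Graph → Set
Connected G = ∀ u v → WalkIn G (λ _ → ⊤) u v

Cycle : Graph → Set
Cycle G = Σ ℕ λ m → Σ (Fin (3 + m) → V G) λ c →
  Injective _≡_ _≡_ c
  × (∀ (i : Fin (2 + m)) → E G (c (inject₁ i)) (c (suc i)))
  × E G (c (fromℕ (2 + m))) (c zero)

Acyclic : Graph → Set
Acyclic G = ¬ Cycle G

IsTree : Graph → Set
IsTree G = IsSimple G × Connected G × Acyclic G

-- Fix a model of the c × c grid in S · T with c = k + 1: a root in every branch set and, for each
-- grid edge, an edge of S · T between the two branch sets together with two legs joining it to the
-- roots inside the branch sets. Call a grid vertex marked if one of its legs meets the central layer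
-- {0} × T; distinct marked vertices own distinct vertices of that layer, so at most n are marked.
-- Off the central layer S · T is a disjoint union of copies of T. The legs of unmarked vertices stay
-- there, so a cycle of grid edges between unmarked vertices would yield a cycle in T: these edges
-- form a forest and are fewer than the unmarked vertices. As every marked vertex spoils at most four
-- of the 2c(c − 1) grid edges, 2c(c − 1) − 4K < c² − K for K marked vertices, i.e. (c − 1)² ≤ 3K ≤ 3n.
-- The first two inequalities hold because □ ⊆ ⊠ ⊆ · on the same vertex set.
module Submission where

open import Defs
open import Data.Nat using (ℕ; _∸_; _^_; _<_; _≤_; _+_; _*_)
open import Data.Fin using (Fin)
open import Data.Product using (_×_)

open import Data.Bool using (Bool; true; false; not; T; _∧_)
open import Data.Bool.Properties using (∧-identityʳ; ∧-zeroʳ; T-∧)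
open import Data.Empty using (⊥; ⊥-elim)
open import Data.Fin using (zero; suc; punchOut; inject₁; fromℕ; toℕ)
open import Data.Fin.Properties using (punchOut-injective; any?; toℕ-inject₁)
  renaming (_≟_ to _≟ᶠ_; suc-injective to fsuc-injective)
open import Data.List using (List; []; _∷_; _++_; length; filterᵇ; tabulate; concat)
open import Data.List.Membership.Propositional using (_∈_; _∉_; lose)
open import Data.List.Membership.Propositional.Properties
  using (∈-concat⁺; ∈-concat⁻; ∈-++⁺ˡ; ∈-++⁺ʳ; ∈-filter⁻)
open import Data.List.Properties using (length-++; length-tabulate; filter-++; filter-some)
import Data.List.Relation.Unary.All as All
import Data.List.Relation.Unary.All.Properties as All
import Data.List.Relation.Unary.AllPairs.Properties as AllPairs
open import Data.List.Relation.Unary.Any using (here; there)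
import Data.List.Relation.Unary.Any.Properties as Any
open import Data.List.Relation.Unary.Unique.Propositional using (Unique; _∷_)
import Data.List.Relation.Unary.Unique.Propositional.Properties as Unique
open import Data.Maybe using (Maybe; just; nothing; _<∣>_; is-just; to-witness-T)
open import Data.Nat using (zero; suc; z≤n; s≤s; z<s)
open import Data.Nat.Properties
open import Algebra.Properties.Semiring.Sum +-*-semiring
  using (sum; sum-syntax; sum-cong-≗; ∑-distrib-+; ∑-comm; *-distribˡ-sum)
open import Data.Nat.Tactic.RingSolver using (solve-∀)
open import Data.Product using (Σ; ∃; _,_; proj₁; proj₂)
open import Data.Product.Properties using (≡-dec)
open import Data.Sum using (_⊎_; inj₁; inj₂)
open import Data.Unit using (⊤; tt)
open import Function using (_∘_)
open import Function.Bundles using (Equivalence)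
open import Function.Definitions using (Injective)
open import Relation.Binary.Construct.Closure.Equivalence using (EqClosure)
import Relation.Binary.Construct.Closure.Equivalence as EqClosure
open import Relation.Binary.Construct.Closure.ReflexiveTransitive
  using (ε; _◅_; _◅◅_) renaming (Star to Walk; map to walk-map; reverse to walk-reverse)
open import Relation.Binary.Construct.Closure.Symmetric using (fwd)
open import Relation.Binary.Definitions using (DecidableEquality)
open import Relation.Binary.PropositionalEquality
open import Relation.Binary.Structures using (IsEquivalence)
open import Relation.Nullary using (¬_; yes; no)
open import Relation.Nullary.Decidable using (T?; does; dec-true; dec-false)

-- Counting in lists

⟦_⟧ : Bool → ℕ
⟦ true ⟧  = 1
⟦ false ⟧ = 0

⟦⟧-true : ∀ {b} → T b → ⟦ b ⟧ ≡ 1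
⟦⟧-true {true} _ = refl

⟦⟧-false : ∀ {b} → ¬ T b → ⟦ b ⟧ ≡ 0
⟦⟧-false {false} _ = refl
⟦⟧-false {true} ¬t = ⊥-elim (¬t _)

<∣>-nothing : ∀ {A : Set} (m : Maybe A) {m′} → (m <∣> m′) ≡ nothing → m ≡ nothing × m′ ≡ nothing
<∣>-nothing nothing none = refl , none

count : {A : Set} → (A → Bool) → List A → ℕ
count p xs = length (filterᵇ p xs)

module _ {A : Set} where

  count-∷ : ∀ (p : A → Bool) x xs → count p (x ∷ xs) ≡ ⟦ p x ⟧ + count p xs
  count-∷ p x xs with p x
  ... | true  = refl
  ... | false = refl

  count-++ : ∀ (p : A → Bool) xs ys → count p (xs ++ ys) ≡ count p xs + count p ys
  count-++ p xs ys = trans (cong length (filter-++ (T? ∘ p) xs ys)) (length-++ (filterᵇ p xs))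

  count-cong : ∀ (p q : A → Bool) {xs} → All.All (λ x → p x ≡ q x) xs → count p xs ≡ count q xs
  count-cong p q {[]} All.[] = refl
  count-cong p q {x ∷ xs} (px≡qx All.∷ rest) = begin
    count p (x ∷ xs)           ≡⟨ count-∷ p x xs ⟩
    ⟦ p x ⟧ + count p xs       ≡⟨ cong₂ _+_ (cong ⟦_⟧ px≡qx) (count-cong p q rest) ⟩
    ⟦ q x ⟧ + count q xs       ≡⟨ count-∷ q x xs ⟨
    count q (x ∷ xs)           ∎
    where open ≡-Reasoning

  count-update : ∀ (p q : A → Bool) {a xs} → Unique xs → a ∈ xs → T (p a) → ¬ T (q a) →
                 (∀ x → x ≢ a → p x ≡ q x) → count p xs ≡ suc (count q xs)
  count-update p q {a} {a ∷ xs} (a∉xs ∷ _) (here refl) pa ¬qa agree = begin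
    count p (a ∷ xs)             ≡⟨ count-∷ p a xs ⟩
    ⟦ p a ⟧ + count p xs         ≡⟨ cong₂ _+_ (⟦⟧-true pa) (count-cong p q (All.map (agree _ ∘ (_∘ sym)) a∉xs)) ⟩
    suc (count q xs)             ≡⟨ cong (λ z → suc (z + count q xs)) (⟦⟧-false ¬qa) ⟨
    suc (⟦ q a ⟧ + count q xs)   ≡⟨ cong suc (count-∷ q a xs) ⟨
    suc (count q (a ∷ xs))       ∎
    where open ≡-Reasoning
  count-update p q {a} {x ∷ xs} (x∉xs ∷ u) (there a∈xs) pa ¬qa agree = begin
    count p (x ∷ xs)             ≡⟨ count-∷ p x xs ⟩
    ⟦ p x ⟧ + count p xs         ≡⟨ cong₂ _+_ (cong ⟦_⟧ (agree x (All.lookup x∉xs a∈xs)))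
                                              (count-update p q u a∈xs pa ¬qa agree) ⟩
    ⟦ q x ⟧ + suc (count q xs)   ≡⟨ +-suc _ _ ⟩
    suc (⟦ q x ⟧ + count q xs)   ≡⟨ cong suc (count-∷ q x xs) ⟨
    suc (count q (x ∷ xs))       ∎
    where open ≡-Reasoning

  count-pos : ∀ (p : A → Bool) {x xs} → x ∈ xs → T (p x) → 0 < count p xs
  count-pos p x∈xs px = filter-some (T? ∘ p) (lose x∈xs px)

  count-not : ∀ (p : A → Bool) xs → count (not ∘ p) xs + count p xs ≡ length xs
  count-not p [] = refl
  count-not p (x ∷ xs) = begin
    count (not ∘ p) (x ∷ xs) + count p (x ∷ xs)                 ≡⟨ cong₂ _+_ (count-∷ (not ∘ p) x xs) (count-∷ p x xs) ⟩
    (⟦ not (p x) ⟧ + count (not ∘ p) xs) + (⟦ p x ⟧ + count p xs) ≡⟨ shuffle ⟦ not (p x) ⟧ ⟦ p x ⟧ _ _ ⟩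
    (⟦ not (p x) ⟧ + ⟦ p x ⟧) + (count (not ∘ p) xs + count p xs) ≡⟨ cong₂ _+_ (one (p x)) (count-not p xs) ⟩
    suc (length xs)                                               ∎
    where
    open ≡-Reasoning
    shuffle : ∀ a b c d → (a + c) + (b + d) ≡ (a + b) + (c + d)
    shuffle = solve-∀
    one : ∀ b → ⟦ not b ⟧ + ⟦ b ⟧ ≡ 1
    one true  = refl
    one false = refl

  unique-injective⇒length≤ : ∀ {n} {xs : List A} → Unique xs → (f : ∀ {x} → x ∈ xs → Fin n) →
                             (∀ {x y} (x∈ : x ∈ xs) (y∈ : y ∈ xs) → f x∈ ≡ f y∈ → x ≡ y) →
                             length xs ≤ n
  unique-injective⇒length≤ {xs = []} _ _ _ = z≤n
  unique-injective⇒length≤ {zero} {x ∷ xs} _ f _ with f (here refl)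
  ... | ()
  unique-injective⇒length≤ {suc n} {x ∷ xs} (x∉xs ∷ u) f f-inj = s≤s (unique-injective⇒length≤ u f′ f′-inj)
    where
    f≢ : ∀ {y} (y∈ : y ∈ xs) → f (here refl) ≢ f (there y∈)
    f≢ y∈ eq = All.lookup x∉xs y∈ (f-inj _ _ eq)
    f′ : ∀ {y} → y ∈ xs → Fin n
    f′ y∈ = punchOut (f≢ y∈)
    f′-inj : ∀ {y z} (y∈ : y ∈ xs) (z∈ : z ∈ xs) → f′ y∈ ≡ f′ z∈ → y ≡ z
    f′-inj y∈ z∈ eq = f-inj (there y∈) (there z∈) (punchOut-injective (f≢ y∈) (f≢ z∈) eq)

  firstJust : {B : Set} → (A → Maybe B) → List A → Maybe B
  firstJust f []       = nothing
  firstJust f (x ∷ xs) = f x <∣> firstJust f xs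

  firstJust-nothing : ∀ {B : Set} (f : A → Maybe B) {x xs} → firstJust f xs ≡ nothing → x ∈ xs → f x ≡ nothing
  firstJust-nothing f {xs = y ∷ _} none (here refl) = proj₁ (<∣>-nothing (f y) none)
  firstJust-nothing f {xs = y ∷ _} none (there x∈) = firstJust-nothing f (proj₂ (<∣>-nothing (f y) none)) x∈

  count-tabulate : ∀ (p : A → Bool) {k} (f : Fin k → A) → count p (tabulate f) ≡ ∑[ i < k ] ⟦ p (f i) ⟧
  count-tabulate p {zero} f = refl
  count-tabulate p {suc k} f = trans (count-∷ p (f zero) _) (cong (⟦ p (f zero) ⟧ +_) (count-tabulate p (f ∘ suc)))

  count-concat : ∀ (p : A → Bool) {k} (F : Fin k → List A) →
                 count p (concat (tabulate F)) ≡ ∑[ i < k ] count p (F i)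
  count-concat p {zero} F = refl
  count-concat p {suc k} F = trans (count-++ p (F zero) _) (cong (count p (F zero) +_) (count-concat p (F ∘ suc)))

  tabulate² : ∀ {p q} → (Fin p → Fin q → A) → List A
  tabulate² f = concat (tabulate λ a → tabulate (f a))

  ∈-tabulate²⁺ : ∀ {p q} (f : Fin p → Fin q → A) a b → f a b ∈ tabulate² f
  ∈-tabulate²⁺ f a b = ∈-concat⁺ (Any.tabulate⁺ a (Any.tabulate⁺ b refl))

  ∈-tabulate²⁻ : ∀ {p q} (f : Fin p → Fin q → A) {x} → x ∈ tabulate² f → ∃ λ a → ∃ λ b → x ≡ f a b
  ∈-tabulate²⁻ f x∈ with Any.tabulate⁻ (∈-concat⁻ (tabulate λ a → tabulate (f a)) x∈)
  ... | a , x∈row = a , Any.tabulate⁻ x∈row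

  tabulate²-unique : ∀ {p q} (f : Fin p → Fin q → A) →
                     (∀ {a b a′ b′} → f a b ≡ f a′ b′ → a ≡ a′ × b ≡ b′) → Unique (tabulate² f)
  tabulate²-unique f f-inj = Unique.concat⁺
    (All.tabulate⁺ (λ a → Unique.tabulate⁺ (proj₂ ∘ f-inj)))
    (AllPairs.tabulate⁺ (λ a≢a′ (x∈ , x∈′) → a≢a′ (row x∈ x∈′)))
    where
    row : ∀ {a a′ x} → x ∈ tabulate (f a) → x ∈ tabulate (f a′) → a ≡ a′
    row x∈ x∈′ with Any.tabulate⁻ x∈ | Any.tabulate⁻ x∈′
    ... | _ , refl | _ , eq = proj₁ (f-inj eq)

  count-tabulate² : ∀ (p : A → Bool) {k l} (f : Fin k → Fin l → A) →
                    count p (tabulate² f) ≡ ∑[ a < k ] ∑[ b < l ] ⟦ p (f a b) ⟧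
  count-tabulate² p f = trans (count-concat p (λ a → tabulate (f a))) (sum-cong-≗ (λ a → count-tabulate p (f a)))

  length-tabulate² : ∀ {p q} (f : Fin p → Fin q → A) → length (tabulate² f) ≡ p * q
  length-tabulate² {zero}      f = refl
  length-tabulate² {suc p} {q} f =
    trans (length-++ (tabulate (f zero))) (cong₂ _+_ (length-tabulate (f zero)) (length-tabulate² (f ∘ suc)))

-- Sums and paths with marked vertices

∑-mono-≤ : ∀ {k} {f g : Fin k → ℕ} → (∀ i → f i ≤ g i) → ∑[ i < k ] f i ≤ ∑[ i < k ] g i
∑-mono-≤ {zero} f≤g = z≤n
∑-mono-≤ {suc k} f≤g = +-mono-≤ (f≤g zero) (∑-mono-≤ (f≤g ∘ suc))

∑-const : ∀ k c → ∑[ i < k ] c ≡ k * c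
∑-const zero c = refl
∑-const (suc k) c = cong (c +_) (∑-const k c)

-- A marked vertex spoils at most two of the k edges of the path x, an end vertex at most one;
-- the summand ⟦ x zero ⟧ records this so that the induction goes through.
path-bound : ∀ k (x : Fin (suc k) → Bool) →
  k + ⟦ x zero ⟧ ≤ ∑[ i < k ] ⟦ not (x (inject₁ i)) ∧ not (x (suc i)) ⟧ + 2 * ∑[ i < suc k ] ⟦ x i ⟧
path-bound zero x with x zero
... | true  = s≤s z≤n
... | false = z≤n
path-bound (suc k) x with path-bound k (x ∘ suc)
... | ih with x zero
... | false with x (suc zero)
...   | false = s≤s ih
...   | true  = ≤-trans (≤-reflexive (trans (+-identityʳ (suc k)) (+-comm 1 k))) ih
path-bound (suc k) x | ih | true = begin
  suc k + 1            ≡⟨ +-comm (suc k) 1 ⟩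
  2 + k                ≤⟨ +-monoʳ-≤ 2 (≤-trans (m≤m+n k _) ih) ⟩
  2 + (G + 2 * S)      ≡⟨ regroup G S ⟩
  G + 2 * (1 + S)      ∎
  where
  open ≤-Reasoning
  regroup : ∀ g s → 2 + (g + 2 * s) ≡ g + 2 * (1 + s)
  regroup = solve-∀
  G = ∑[ i < k ] ⟦ not (x (suc (inject₁ i))) ∧ not (x (suc (suc i))) ⟧
  S = ∑[ i < suc k ] ⟦ x (suc i) ⟧

parallel-paths-bound : ∀ p k (x : Fin p → Fin (suc k) → Bool) →
  p * k ≤ ∑[ a < p ] ∑[ i < k ] ⟦ not (x a (inject₁ i)) ∧ not (x a (suc i)) ⟧
          + 2 * ∑[ a < p ] ∑[ i < suc k ] ⟦ x a i ⟧
parallel-paths-bound p k x = begin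
  p * k                                   ≡⟨ ∑-const p k ⟨
  ∑[ a < p ] k                            ≤⟨ ∑-mono-≤ (λ a → ≤-trans (m≤m+n k _) (path-bound k (x a))) ⟩
  ∑[ a < p ] (G a + 2 * S a)              ≡⟨ ∑-distrib-+ G (λ a → 2 * S a) ⟩
  sum G + ∑[ a < p ] (2 * S a)            ≡⟨ cong (sum G +_) (*-distribˡ-sum 2 S) ⟨
  sum G + 2 * sum S                       ∎
  where
  open ≤-Reasoning
  G S : Fin p → ℕ
  G a = ∑[ i < k ] ⟦ not (x a (inject₁ i)) ∧ not (x a (suc i)) ⟧
  S a = ∑[ i < suc k ] ⟦ x a i ⟧

-- Walks and simple paths

module _ {I : Set} {T : I → I → Set} where

  steps : ∀ {x y} → Walk T x y → ℕ
  steps ε       = 0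
  steps (_ ◅ p) = suc (steps p)

  vertex : ∀ {x y} (p : Walk T x y) → Fin (suc (steps p)) → I
  vertex {x} p       zero    = x
  vertex     (_ ◅ p) (suc i) = vertex p i

  vertex-last : ∀ {x y} (p : Walk T x y) → vertex p (fromℕ (steps p)) ≡ y
  vertex-last ε       = refl
  vertex-last (_ ◅ p) = vertex-last p

  vertex-step : ∀ {x y} (p : Walk T x y) (i : Fin (steps p)) → T (vertex p (inject₁ i)) (vertex p (suc i))
  vertex-step (t ◅ p) zero    = t
  vertex-step (t ◅ p) (suc i) = vertex-step p i

  Simple : ∀ {x y} → Walk T x y → Set
  Simple ε           = ⊤
  Simple {x} (_ ◅ p) = (∀ i → vertex p i ≢ x) × Simple p

  simple⇒injective : ∀ {x y} (p : Walk T x y) → Simple p → Injective _≡_ _≡_ (vertex p)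
  simple⇒injective p       _            {zero}  {zero}  _  = refl
  simple⇒injective (_ ◅ p) (x∉p , _)    {zero}  {suc j} eq = ⊥-elim (x∉p j (sym eq))
  simple⇒injective (_ ◅ p) (x∉p , _)    {suc i} {zero}  eq = ⊥-elim (x∉p i eq)
  simple⇒injective (_ ◅ p) (_ , simple) {suc i} {suc j} eq = cong suc (simple⇒injective p simple eq)

  SimplePath : I → I → Set
  SimplePath x y = Σ (Walk T x y) Simple

  suffix : ∀ {x y} (p : Walk T x y) → Simple p → (i : Fin (suc (steps p))) → SimplePath (vertex p i) y
  suffix p       simple       zero    = p , simple
  suffix (_ ◅ p) (_ , simple) (suc i) = suffix p simple i

  shortcut : DecidableEquality I → ∀ {x y} → Walk T x y → SimplePath x y
  shortcut _≟_ ε = ε , tt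
  shortcut _≟_ {x} (t ◅ p) with shortcut _≟_ p
  ... | q , simple with any? (λ i → vertex q i ≟ x)
  ...   | yes (i , refl) = suffix q simple i
  ...   | no x∉q         = t ◅ q , (λ i eq → x∉q (i , eq)) , simple

  cycle-of-path : (G : Graph) (f : I → V G) → (∀ {a b} → T a b → E G (f a) (f b)) →
                  ∀ {x y} (p : Walk T x y) → 2 ≤ steps p → Injective _≡_ _≡_ (f ∘ vertex p) →
                  E G (f y) (f x) → Cycle G
  cycle-of-path G f f-edge (_ ◅ ε) (s≤s ()) _ _
  cycle-of-path G f f-edge p@(_ ◅ _ ◅ q) _ injective closing =
    steps q , f ∘ vertex p , injective , (λ i → f-edge (vertex-step p i)) ,
    subst (λ z → E G (f z) (f (vertex p zero))) (sym (vertex-last p)) closing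

-- Union–find. By `bridge`, each edge of L joins two components of the edges after it, so adding it
-- lowers the number of components, i.e. of roots of the representative function, by one.
module ForestBound
  {I Edge : Set} (_≟_ : DecidableEquality I)
  (vertices : List I) (vertices-unique : Unique vertices) (vertices-complete : ∀ x → x ∈ vertices)
  (from to : Edge → I) (Y : I → Bool)
  where

  Good : Edge → Set
  Good e = T (Y (from e)) × T (Y (to e))

  Link : List Edge → I → I → Set
  Link L x y = Σ Edge λ e → e ∈ L × from e ≡ x × to e ≡ y

  Reachable : List Edge → I → I → Set
  Reachable L = EqClosure (Link L)

  module _ (bridge : ∀ {L e} → All.All Good L → Good e → e ∉ L → ¬ Reachable L (from e) (to e)) where

    isRoot : (I → I) → I → Bool
    isRoot rep x = Y x ∧ does (rep x ≟ x)

    record Partition (L : List Edge) : Set where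
      field
        rep       : I → I
        rep-Y     : ∀ {x} → T (Y x) → T (Y (rep x))
        rep-idem  : ∀ {x} → T (Y x) → rep (rep x) ≡ rep x
        rep-reach : ∀ {x} → T (Y x) → Reachable L x (rep x)
        rep-count : count (isRoot rep) vertices + length L ≡ count Y vertices

    discrete : Partition []
    discrete = record
      { rep = λ x → x ; rep-Y = λ y → y ; rep-idem = λ _ → refl ; rep-reach = λ _ → ε
      ; rep-count = trans (+-identityʳ _)
          (count-cong _ Y (All.universal (λ x → trans (cong (Y x ∧_) (dec-true (x ≟ x) refl)) (∧-identityʳ (Y x)))
                                         vertices))
      }

    module Merge {L e} (good-L : All.All Good L) (good-e : Good e) (e∉L : e ∉ L) (P : Partition L) where

      open Partition P

      Y-from = proj₁ good-e
      Y-to   = proj₂ good-e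
      r  = rep (from e)
      r′ = rep (to e)

      r≢r′ : r ≢ r′
      r≢r′ r≡r′ = bridge good-L good-e e∉L
        (EqClosure.transitive _ (rep-reach Y-from)
          (subst (λ z → Reachable L z (to e)) (sym r≡r′) (EqClosure.symmetric _ (rep-reach Y-to))))

      rep′ : I → I
      rep′ x with rep x ≟ r′
      ... | yes _ = r
      ... | no  _ = rep x

      rep′-moved : ∀ {x} → rep x ≡ r′ → rep′ x ≡ r
      rep′-moved {x} eq with rep x ≟ r′
      ... | yes _  = refl
      ... | no neq = ⊥-elim (neq eq)

      rep′-kept : ∀ {x} → rep x ≢ r′ → rep′ x ≡ rep x
      rep′-kept {x} neq with rep x ≟ r′
      ... | yes eq = ⊥-elim (neq eq)
      ... | no  _  = refl

      rep′-Y : ∀ {x} → T (Y x) → T (Y (rep′ x))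
      rep′-Y {x} y with rep x ≟ r′
      ... | yes _ = rep-Y Y-from
      ... | no  _ = rep-Y y

      rep′-idem : ∀ {x} → T (Y x) → rep′ (rep′ x) ≡ rep′ x
      rep′-idem {x} y with rep x ≟ r′
      ... | yes _  = trans (rep′-kept (λ eq → r≢r′ (trans (sym (rep-idem Y-from)) eq))) (rep-idem Y-from)
      ... | no neq = trans (rep′-kept (λ eq → neq (trans (sym (rep-idem y)) eq))) (rep-idem y)

      grow : ∀ {x y} → Reachable L x y → Reachable (e ∷ L) x y
      grow = EqClosure.map (λ (e′ , e′∈L , ends) → e′ , there e′∈L , ends)

      rep′-reach : ∀ {x} → T (Y x) → Reachable (e ∷ L) x (rep′ x)
      rep′-reach {x} y with rep x ≟ r′
      ... | no  _  = grow (rep-reach y)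
      ... | yes eq = x~r′ ◅◅ (r′~to ◅◅ (to~from ◅◅ from~r))
        where
        x~r′    = grow (subst (Reachable L x) eq (rep-reach y))
        r′~to   = grow (EqClosure.symmetric _ (rep-reach Y-to))
        to~from = EqClosure.symmetric _ (fwd (e , here refl , refl , refl) ◅ ε)
        from~r  = grow (rep-reach Y-from)

      r′-root : T (isRoot rep r′)
      r′-root rewrite dec-true (rep r′ ≟ r′) (rep-idem Y-to) | ∧-identityʳ (Y r′) = rep-Y Y-to

      r′-not-root : ¬ T (isRoot rep′ r′)
      r′-not-root t rewrite rep′-moved (rep-idem Y-to) | dec-false (r ≟ r′) r≢r′ | ∧-zeroʳ (Y r′) = t

      roots-agree : ∀ x → x ≢ r′ → isRoot rep x ≡ isRoot rep′ x
      roots-agree x x≢r′ with rep x ≟ r′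
      ... | no _   = refl
      ... | yes eq rewrite dec-false (rep x ≟ x) (λ x~ → x≢r′ (trans (sym x~) eq))
                         | dec-false (r ≟ x) (λ { refl → r≢r′ (trans (sym (rep-idem Y-from)) eq) }) = refl

      rep′-count : count (isRoot rep′) vertices + suc (length L) ≡ count Y vertices
      rep′-count = begin
        count (isRoot rep′) vertices + suc (length L)   ≡⟨ +-suc _ _ ⟩
        suc (count (isRoot rep′) vertices) + length L   ≡⟨ cong (_+ length L) roots-drop ⟨
        count (isRoot rep) vertices + length L           ≡⟨ rep-count ⟩
        count Y vertices                                 ∎
        where
        open ≡-Reasoning
        roots-drop = count-update (isRoot rep) (isRoot rep′) vertices-unique (vertices-complete r′)
                                  r′-root r′-not-root roots-agree

    merge : ∀ {L e} → All.All Good L → Good e → e ∉ L → Partition L → Partition (e ∷ L)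
    merge good-L good-e e∉L P = record
      { rep = rep′ ; rep-Y = rep′-Y ; rep-idem = rep′-idem ; rep-reach = rep′-reach ; rep-count = rep′-count }
      where open Merge good-L good-e e∉L P

    partition : ∀ L → Unique L → All.All Good L → Partition L
    partition []      _            _                  = discrete
    partition (e ∷ L) (e∉L ∷ uniq) (good-e All.∷ good) =
      merge good good-e (All.All¬⇒¬Any e∉L) (partition L uniq good)

    forest-bound : ∀ L → Unique L → All.All Good L → count Y vertices ≡ 0 ⊎ length L < count Y vertices
    forest-bound [] _ _ with count Y vertices
    ... | zero  = inj₁ refl
    ... | suc _ = inj₂ (s≤s z≤n)
    forest-bound L@(e ∷ _) uniq good@((Y-from , _) All.∷ _) = inj₂ (begin
      1 + length L                              ≤⟨ +-monoˡ-≤ (length L) (count-pos (isRoot rep) (vertices-complete root) root-is-root) ⟩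
      count (isRoot rep) vertices + length L    ≡⟨ rep-count ⟩
      count Y vertices                          ∎)
      where
      open ≤-Reasoning
      open Partition (partition L uniq good)
      root = rep (from e)
      root-is-root : T (isRoot rep root)
      root-is-root rewrite dec-true (rep root ≟ root) (rep-idem Y-from) | ∧-identityʳ (Y root) = rep-Y Y-from

-- Minors and products

≼-mono : ∀ {H : Graph} {X : Set} {E₁ E₂ : X → X → Set} → (∀ {u v} → E₁ u v → E₂ u v) →
         H ≼ record { V = X ; E = E₁ } → H ≼ record { V = X ; E = E₂ }
≼-mono {X = X} {E₁} {E₂} E₁⊆E₂ model = record
  { branch = branch ; nonempty = nonempty ; disjoint = disjoint
  ; connected = λ h u v u∈ v∈ → map-walk (connected h u v u∈ v∈)
  ; edges = λ h h′ hh′ → let (u , v , u∈ , v∈ , uv) = edges h h′ hh′ in u , v , u∈ , v∈ , E₁⊆E₂ uv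
  }
  where
  open MinorModel model
  map-walk : ∀ {P u v} → WalkIn (record { V = X ; E = E₁ }) P u v → WalkIn (record { V = X ; E = E₂ }) P u v
  map-walk (here p)      = here p
  map-walk (step p uw w) = step p (E₁⊆E₂ uw) (map-walk w)

IsGM-mono : ∀ {X : Set} {E₁ E₂ : X → X → Set} {a b} → (∀ {u v} → E₁ u v → E₂ u v) →
            IsGM (record { V = X ; E = E₁ }) a → IsGM (record { V = X ; E = E₂ }) b → a ≤ b
IsGM-mono E₁⊆E₂ (grid-a , _) (_ , maximal-b) = maximal-b _ (≼-mono E₁⊆E₂ grid-a)

Loopless : Graph → Set
Loopless G = ∀ u → ¬ E G u u

□⊆⊠ : ∀ {G H} → Loopless G → Loopless H → ∀ {u v} → E (G □ H) u v → E (G ⊠ H) u v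
□⊆⊠ {H = H} _ H-loopless (inj₁ (refl , uv)) =
  (inj₁ refl , inj₂ uv) , λ eq → H-loopless _ (subst (E H _) (sym (cong proj₂ eq)) uv)
□⊆⊠ {G = G} G-loopless _ (inj₂ (refl , uv)) =
  (inj₂ uv , inj₁ refl) , λ eq → G-loopless _ (subst (E G _) (sym (cong proj₁ eq)) uv)

⊠⊆· : ∀ {G H} {u v} → E (G ⊠ H) u v → E (G · H) u v
⊠⊆· ((inj₂ uv , _) , _)              = inj₁ uv
⊠⊆· ((inj₁ refl , inj₂ uv) , _)      = inj₂ (refl , uv)
⊠⊆· ((inj₁ refl , inj₁ refl) , u≢u)  = ⊥-elim (u≢u refl)

star-loopless : ∀ m → Loopless (Star m)
star-loopless m u (inj₁ (u≡0 , u≢0)) = u≢0 u≡0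
star-loopless m u (inj₂ (u≡0 , u≢0)) = u≢0 u≡0

-- The grid

data GridEdge (k : ℕ) : Set where
  horizontal : Fin (suc k) → Fin k → GridEdge k
  vertical   : Fin k → Fin (suc k) → GridEdge k

module _ {k : ℕ} where

  from to : GridEdge k → V (Grid (suc k))
  from (horizontal a b) = a , inject₁ b
  from (vertical a b)   = inject₁ a , b
  to (horizontal a b) = a , suc b
  to (vertical a b)   = suc a , b

  gridEdge-adjacent : ∀ e → E (Grid (suc k)) (from e) (to e)
  gridEdge-adjacent (horizontal a b) = inj₁ (refl , inj₁ (cong suc (sym (toℕ-inject₁ b))))
  gridEdge-adjacent (vertical a b)   = inj₂ (refl , inj₁ (cong suc (sym (toℕ-inject₁ a))))

  level : V (Grid (suc k)) → ℕ
  level (a , b) = toℕ a + toℕ b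

  level-to : ∀ e → level (to e) ≡ suc (level (from e))
  level-to (horizontal a b) = trans (+-suc (toℕ a) (toℕ b)) (cong (λ z → suc (toℕ a + z)) (sym (toℕ-inject₁ b)))
  level-to (vertical a b)   = cong (λ z → suc (z + toℕ b)) (sym (toℕ-inject₁ a))

  from≢to : ∀ e → from e ≢ to e
  from≢to e eq = 1+n≢n (sym (trans (cong level eq) (level-to e)))

  reversed-impossible : ∀ e e′ → from e′ ≡ to e → to e′ ≡ from e → ⊥
  reversed-impossible e e′ e′₀ e′₁ = m≢1+n+m (level (from e)) {1} (begin
    level (from e)         ≡⟨ cong level e′₁ ⟨
    level (to e′)          ≡⟨ level-to e′ ⟩
    suc (level (from e′))  ≡⟨ cong (λ x → suc (level x)) e′₀ ⟩
    suc (level (to e))     ≡⟨ cong suc (level-to e) ⟩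
    2 + level (from e)     ∎)
    where open ≡-Reasoning

  ends-injective : ∀ e e′ → from e ≡ from e′ → to e ≡ to e′ → e ≡ e′
  ends-injective (horizontal a b) (horizontal a′ b′) eq₀ eq₁ =
    cong₂ horizontal (cong proj₁ eq₀) (fsuc-injective (cong proj₂ eq₁))
  ends-injective (vertical a b)   (vertical a′ b′)   eq₀ eq₁ =
    cong₂ vertical (fsuc-injective (cong proj₁ eq₁)) (cong proj₂ eq₀)
  ends-injective (horizontal a b) (vertical a′ b′)  eq₀ eq₁ =
    ⊥-elim (1+n≢n (trans (cong (toℕ ∘ proj₁) (sym eq₁)) (trans (cong (toℕ ∘ proj₁) eq₀) (toℕ-inject₁ a′))))
  ends-injective (vertical a b)   (horizontal a′ b′) eq₀ eq₁ =
    ⊥-elim (1+n≢n (trans (cong (toℕ ∘ proj₁) eq₁) (trans (cong (toℕ ∘ proj₁) (sym eq₀)) (toℕ-inject₁ a))))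

  gridVertices : List (V (Grid (suc k)))
  gridVertices = tabulate² _,_

  gridVertices-unique : Unique gridVertices
  gridVertices-unique = tabulate²-unique _,_ λ { refl → refl , refl }

  ∈-gridVertices : ∀ v → v ∈ gridVertices
  ∈-gridVertices (a , b) = ∈-tabulate²⁺ _,_ a b

  gridEdges : List (GridEdge k)
  gridEdges = tabulate² horizontal ++ tabulate² vertical

  gridEdges-unique : Unique gridEdges
  gridEdges-unique = Unique.++⁺ (tabulate²-unique horizontal λ { refl → refl , refl })
                                (tabulate²-unique vertical λ { refl → refl , refl })
                                disjoint
    where
    disjoint : ∀ {e} → ¬ (e ∈ tabulate² horizontal × e ∈ tabulate² vertical)
    disjoint (e∈h , e∈v) with ∈-tabulate²⁻ horizontal e∈h | ∈-tabulate²⁻ vertical e∈v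
    ... | _ , _ , refl | _ , _ , ()

  ∈-gridEdges : ∀ e → e ∈ gridEdges
  ∈-gridEdges (horizontal a b) = ∈-++⁺ˡ (∈-tabulate²⁺ horizontal a b)
  ∈-gridEdges (vertical a b)   = ∈-++⁺ʳ (tabulate² horizontal) (∈-tabulate²⁺ vertical a b)

  grid-edge-bound : (X : V (Grid (suc k)) → Bool) →
    2 * (suc k * k) ≤ count (λ e → not (X (from e)) ∧ not (X (to e))) gridEdges + 4 * count X gridVertices
  grid-edge-bound X = begin
    2 * (suc k * k)                          ≡⟨ double (suc k * k) ⟩
    suc k * k + suc k * k                    ≤⟨ +-mono-≤ (parallel-paths-bound (suc k) k (λ a b → X (a , b)))
                                                          (parallel-paths-bound (suc k) k (λ b a → X (a , b))) ⟩
    (Gₕ + 2 * K) + (Gᵥ′ + 2 * K′)            ≡⟨ cong₂ (λ g k′ → (Gₕ + 2 * K) + (g + 2 * k′))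
                                                    (∑-comm (λ b a → ⟦ good (vertical a b) ⟧))
                                                    (∑-comm (λ b a → ⟦ X (a , b) ⟧)) ⟩
    (Gₕ + 2 * K) + (Gᵥ + 2 * K)              ≡⟨ regroup Gₕ Gᵥ K ⟩
    (Gₕ + Gᵥ) + 4 * K                        ≡⟨ cong₂ (λ g k′ → g + 4 * k′)
                                                    (trans (count-++ good (tabulate² horizontal) _)
                                                      (cong₂ _+_ (count-tabulate² good horizontal) (count-tabulate² good vertical)))
                                                    (count-tabulate² X _,_) ⟨
    count good gridEdges + 4 * count X gridVertices ∎
    where
    open ≤-Reasoning
    good : GridEdge k → Bool
    good e = not (X (from e)) ∧ not (X (to e))
    Gₕ Gᵥ Gᵥ′ K K′ : ℕ
    Gₕ  = ∑[ a < suc k ] ∑[ b < k ] ⟦ good (horizontal a b) ⟧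
    Gᵥ  = ∑[ a < k ] ∑[ b < suc k ] ⟦ good (vertical a b) ⟧
    Gᵥ′ = ∑[ b < suc k ] ∑[ a < k ] ⟦ good (vertical a b) ⟧
    K   = ∑[ a < suc k ] ∑[ b < suc k ] ⟦ X (a , b) ⟧
    K′  = ∑[ b < suc k ] ∑[ a < suc k ] ⟦ X (a , b) ⟧
    double : ∀ x → 2 * x ≡ x + x
    double = solve-∀
    regroup : ∀ g g′ x → (g + 2 * x) + (g′ + 2 * x) ≡ (g + g′) + 4 * x
    regroup = solve-∀

square-bound : ∀ c′ g k y → 2 * (suc c′ * c′) ≤ g + 4 * k → y ≡ 0 ⊎ g < y → y + k ≡ suc c′ * suc c′ →
               c′ * c′ ≤ 3 * k
square-bound c′ g k y edges (inj₁ refl) k≡c² = begin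
  c′ * c′            ≤⟨ *-mono-≤ (n≤1+n c′) (n≤1+n c′) ⟩
  suc c′ * suc c′    ≡⟨ k≡c² ⟨
  k                  ≤⟨ m≤n*m k 3 ⟩
  3 * k              ∎
  where open ≤-Reasoning
square-bound c′ g k y edges (inj₂ g<y) y+k≡c² = +-cancelʳ-≤ (c * c) (c′ * c′) (3 * k) (begin
  c′ * c′ + c * c          ≡⟨ expand c′ ⟩
  suc (2 * (c * c′))       ≤⟨ s≤s edges ⟩
  suc g + 4 * k            ≤⟨ +-monoˡ-≤ (4 * k) g<y ⟩
  y + 4 * k                ≡⟨ split y k ⟩
  (y + k) + 3 * k          ≡⟨ cong (_+ 3 * k) y+k≡c² ⟩
  c * c + 3 * k            ≡⟨ +-comm (c * c) (3 * k) ⟩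
  3 * k + c * c            ∎)
  where
  open ≤-Reasoning
  c = suc c′
  expand : ∀ x → x * x + suc x * suc x ≡ suc (2 * (suc x * x))
  expand = solve-∀
  split : ∀ y k → y + 4 * k ≡ (y + k) + 3 * k
  split = solve-∀

-- A grid model in S · T

module GridModelInLexProduct
  (m n : ℕ) (R : Fin n → Fin n → Set) (tree : IsTree (FinGraph n R))
  (k : ℕ) (model : Grid (suc k) ≼ (Star m · FinGraph n R))
  where

  open MinorModel model

  Host : Graph
  Host = Star m · FinGraph n R

  GridVertex : Set
  GridVertex = V (Grid (suc k))

  _≟ᵍ_ : DecidableEquality GridVertex
  _≟ᵍ_ = ≡-dec _≟ᶠ_ _≟ᶠ_

  _≟ʰ_ : DecidableEquality (V Host)
  _≟ʰ_ = ≡-dec _≟ᶠ_ _≟ᶠ_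

  root : GridVertex → V Host
  root h = proj₁ (nonempty h)

  root∈ : ∀ h → branch h (root h)
  root∈ h = proj₂ (nonempty h)

  module _ (e : GridEdge k) where
    private
      port = edges (from e) (to e) (gridEdge-adjacent e)

    port⁻ port⁺ : V Host
    port⁻ = proj₁ port
    port⁺ = proj₁ (proj₂ port)

    port⁻∈ : branch (from e) port⁻
    port⁻∈ = proj₁ (proj₂ (proj₂ port))

    port⁺∈ : branch (to e) port⁺
    port⁺∈ = proj₁ (proj₂ (proj₂ (proj₂ port)))

    port-edge : E Host port⁻ port⁺
    port-edge = proj₂ (proj₂ (proj₂ (proj₂ port)))

    leg⁻ : WalkIn Host (branch (from e)) (root (from e)) port⁻
    leg⁻ = connected (from e) _ _ (root∈ (from e)) port⁻∈

    leg⁺ : WalkIn Host (branch (to e)) (root (to e)) port⁺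
    leg⁺ = connected (to e) _ _ (root∈ (to e)) port⁺∈

  Central : GridVertex → Set
  Central h = Σ (Fin n) λ t → branch h (zero , t)

  centreOn : ∀ {P u v} → WalkIn Host P u v → Maybe (Σ (Fin n) λ t → P (zero , t))
  centreOn (here {zero , t} p)      = just (t , p)
  centreOn (here {suc _ , _} _)     = nothing
  centreOn (step {zero , t} p _ _)  = just (t , p)
  centreOn (step {suc _ , _} _ _ w) = centreOn w

  centreOnLeg⁻ centreOnLeg⁺ : ∀ h → GridEdge k → Maybe (Central h)
  centreOnLeg⁻ h e with from e ≟ᵍ h
  ... | yes refl = centreOn (leg⁻ e)
  ... | no  _    = nothing
  centreOnLeg⁺ h e with to e ≟ᵍ h
  ... | yes refl = centreOn (leg⁺ e)
  ... | no  _    = nothing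

  centralWitness : ∀ h → Maybe (Central h)
  centralWitness h = firstJust (λ e → centreOnLeg⁻ h e <∣> centreOnLeg⁺ h e) gridEdges

  marked unmarked : GridVertex → Bool
  marked h   = is-just (centralWitness h)
  unmarked h = not (marked h)

  legs-clear : ∀ {h} → T (unmarked h) → ∀ e → centreOnLeg⁻ h e ≡ nothing × centreOnLeg⁺ h e ≡ nothing
  legs-clear {h} u e with centralWitness h in eq
  ... | nothing = <∣>-nothing (centreOnLeg⁻ h e) (firstJust-nothing _ eq (∈-gridEdges e))

  leg⁻-clear : ∀ e → T (unmarked (from e)) → centreOn (leg⁻ e) ≡ nothing
  leg⁻-clear e u with from e ≟ᵍ from e | proj₁ (legs-clear u e)
  ... | yes refl | clear = clear
  ... | no  ne   | _     = ⊥-elim (ne refl)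

  leg⁺-clear : ∀ e → T (unmarked (to e)) → centreOn (leg⁺ e) ≡ nothing
  leg⁺-clear e u with to e ≟ᵍ to e | proj₂ (legs-clear u e)
  ... | yes refl | clear = clear
  ... | no  ne   | _     = ⊥-elim (ne refl)

  LayerEdge : V Host → V Host → Set
  LayerEdge x y = proj₁ x ≡ proj₁ y × R (proj₂ x) (proj₂ y)

  LayerEdge-sym : ∀ {x y} → LayerEdge x y → LayerEdge y x
  LayerEdge-sym (same , xy) = sym same , proj₁ (proj₁ tree) _ _ xy

  OffCentre : V Host → Set
  OffCentre x = proj₁ x ≢ zero

  off-centre-edge : ∀ {x y} → OffCentre x → OffCentre y → E Host x y → LayerEdge x y
  off-centre-edge x≢0 _   (inj₁ (inj₁ (x≡0 , _))) = ⊥-elim (x≢0 x≡0)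
  off-centre-edge _   y≢0 (inj₁ (inj₂ (y≡0 , _))) = ⊥-elim (y≢0 y≡0)
  off-centre-edge _   _   (inj₂ layer)            = layer

  module _ {P : V Host → Set} where

    clear⇒start-off-centre : ∀ {u v} (w : WalkIn Host P u v) → centreOn w ≡ nothing → OffCentre u
    clear⇒start-off-centre (here {suc _ , _} _)     _ ()
    clear⇒start-off-centre (step {suc _ , _} _ _ _) _ ()

    clear⇒end-off-centre : ∀ {u v} (w : WalkIn Host P u v) → centreOn w ≡ nothing → OffCentre v
    clear⇒end-off-centre (here {suc _ , _} _)     _     ()
    clear⇒end-off-centre (step {suc _ , _} _ _ w) clear = clear⇒end-off-centre w clear

    clear⇒layer-walk : ∀ {u v} (w : WalkIn Host P u v) → centreOn w ≡ nothing →
                       Walk (λ x y → LayerEdge x y × P x × P y) u v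
    clear⇒layer-walk (here {suc _ , _} _)      _     = ε
    clear⇒layer-walk (step {suc _ , _} p uw w) clear =
      (off-centre-edge (λ ()) (clear⇒start-off-centre w clear) uw , p , first w) ◅ clear⇒layer-walk w clear
      where
      first : ∀ {u v} → WalkIn Host P u v → P u
      first (here p)     = p
      first (step p _ _) = p

  SameBranch : V Host → V Host → Set
  SameBranch x y = Σ GridVertex λ h → branch h x × branch h y

  PortPair : List (GridEdge k) → V Host → V Host → Set
  PortPair L x y = Σ (GridEdge k) λ e → e ∈ L × ((port⁻ e ≡ x × port⁺ e ≡ y) ⊎ (port⁺ e ≡ x × port⁻ e ≡ y))

  Step : List (GridEdge k) → V Host → V Host → Set
  Step L x y = LayerEdge x y × (SameBranch x y ⊎ PortPair L x y)

  Step-sym : ∀ {L x y} → Step L x y → Step L y x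
  Step-sym (layer , inj₁ (h , x∈ , y∈))               = LayerEdge-sym layer , inj₁ (h , y∈ , x∈)
  Step-sym (layer , inj₂ (e , e∈L , inj₁ (e⁻ , e⁺)))  = LayerEdge-sym layer , inj₂ (e , e∈L , inj₂ (e⁺ , e⁻))
  Step-sym (layer , inj₂ (e , e∈L , inj₂ (e⁺ , e⁻)))  = LayerEdge-sym layer , inj₂ (e , e∈L , inj₁ (e⁻ , e⁺))

  Step-isEquivalence : ∀ L → IsEquivalence (Walk (Step L))
  Step-isEquivalence L = record { refl = ε ; sym = walk-reverse Step-sym ; trans = _◅◅_ }

  open ForestBound _≟ᵍ_ gridVertices gridVertices-unique ∈-gridVertices from to unmarked
    using (Good; Link; Reachable; forest-bound)

  leg⁻-steps : ∀ L e → T (unmarked (from e)) → Walk (Step L) (root (from e)) (port⁻ e)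
  leg⁻-steps L e u = walk-map (λ (layer , x∈ , y∈) → layer , inj₁ (from e , x∈ , y∈))
                              (clear⇒layer-walk (leg⁻ e) (leg⁻-clear e u))

  leg⁺-steps : ∀ L e → T (unmarked (to e)) → Walk (Step L) (port⁺ e) (root (to e))
  leg⁺-steps L e u = walk-reverse Step-sym (walk-map (λ (layer , x∈ , y∈) → layer , inj₁ (to e , x∈ , y∈))
                                                     (clear⇒layer-walk (leg⁺ e) (leg⁺-clear e u)))

  port-layer-edge : ∀ e → Good e → LayerEdge (port⁻ e) (port⁺ e)
  port-layer-edge e (u⁻ , u⁺) = off-centre-edge (clear⇒end-off-centre (leg⁻ e) (leg⁻-clear e u⁻))
                                           (clear⇒end-off-centre (leg⁺ e) (leg⁺-clear e u⁺)) (port-edge e)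

  reachable⇒walk : ∀ {L} → All.All Good L → ∀ {h h′} → Reachable L h h′ → Walk (Step L) (root h) (root h′)
  reachable⇒walk {L} good-L = EqClosure.gfold (Step-isEquivalence L) root link⇒walk
    where
    link⇒walk : ∀ {h h′} → Link L h h′ → Walk (Step L) (root h) (root h′)
    link⇒walk (e , e∈L , refl , refl) =
      leg⁻-steps L e (proj₁ good-e) ◅◅
        ((port-layer-edge e good-e , inj₂ (e , e∈L , inj₁ (refl , refl))) ◅ leg⁺-steps L e (proj₂ good-e))
      where good-e = All.lookup good-L e∈L

  vertex-layer : ∀ {L x y} (p : Walk (Step L) x y) i → proj₁ (vertex p i) ≡ proj₁ x
  vertex-layer p       zero    = refl
  vertex-layer (s ◅ p) (suc i) = trans (vertex-layer p i) (sym (proj₁ (proj₁ s)))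

  -- With two or more steps the closing edge yields a cycle of T; shorter paths contradict the
  -- disjointness of the branch sets or e ∉ L.
  no-closable-path : ∀ {L e x y} → e ∉ L → branch (to e) x → branch (from e) y → R (proj₂ y) (proj₂ x) →
                     (p : Walk (Step L) x y) → Simple p → ⊥
  no-closable-path {e = e} _ x∈ y∈ _ ε _ = from≢to e (sym (disjoint (to e) (from e) _ x∈ y∈))
  no-closable-path {e = e} _ x∈ y∈ _ ((_ , inj₁ (h , h∋x , h∋y)) ◅ ε) _ =
    from≢to e (trans (sym (disjoint h (from e) _ h∋y y∈)) (disjoint h (to e) _ h∋x x∈))
  no-closable-path {e = e} _ x∈ y∈ _ ((_ , inj₂ (e′ , _ , inj₁ (refl , refl))) ◅ ε) _ =
    reversed-impossible e e′ (disjoint (from e′) (to e) _ (port⁻∈ e′) x∈)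
                             (disjoint (to e′) (from e) _ (port⁺∈ e′) y∈)
  no-closable-path {e = e} e∉L x∈ y∈ _ ((_ , inj₂ (e′ , e′∈L , inj₂ (refl , refl))) ◅ ε) _ =
    e∉L (subst (_∈ _) (ends-injective e′ e (disjoint (from e′) (from e) _ (port⁻∈ e′) y∈)
                                            (disjoint (to e′) (to e) _ (port⁺∈ e′) x∈)) e′∈L)
  no-closable-path _ _ _ closing p@(_ ◅ _ ◅ _) simple =
    proj₂ (proj₂ tree)
      (cycle-of-path (FinGraph n R) proj₂ (λ s → proj₂ (proj₁ s)) p (s≤s (s≤s z≤n)) injective closing)
    where
    injective : Injective _≡_ _≡_ (proj₂ ∘ vertex p)
    injective {i} {j} eq =
      simple⇒injective p simple (cong₂ _,_ (trans (vertex-layer p i) (sym (vertex-layer p j))) eq)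

  good-edge-bridge : ∀ {L e} → All.All Good L → Good e → e ∉ L → ¬ Reachable L (from e) (to e)
  good-edge-bridge {L} {e} good-L good-e e∉L reach =
    no-closable-path e∉L (port⁺∈ e) (port⁻∈ e) (proj₂ (port-layer-edge e good-e)) (proj₁ path) (proj₂ path)
    where
    path = shortcut _≟ʰ_ (leg⁺-steps L e (proj₂ good-e)
                          ◅◅ (walk-reverse Step-sym (reachable⇒walk good-L reach) ◅◅ leg⁻-steps L e (proj₁ good-e)))

  marked-bound : count marked gridVertices ≤ n
  marked-bound =
    unique-injective⇒length≤ (Unique.filter⁺ (T? ∘ marked) gridVertices-unique) (proj₁ ∘ centre) centre-injective
    where
    centre : ∀ {h} → h ∈ filterᵇ marked gridVertices → Central h
    centre {h} h∈ = to-witness-T (centralWitness h) (proj₂ (∈-filter⁻ (T? ∘ marked) h∈))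
    centre-injective : ∀ {h h′} (h∈ : h ∈ filterᵇ marked gridVertices) (h′∈ : h′ ∈ filterᵇ marked gridVertices) →
                       proj₁ (centre h∈) ≡ proj₁ (centre h′∈) → h ≡ h′
    centre-injective {h} {h′} h∈ h′∈ eq =
      disjoint h h′ _ (proj₂ (centre h∈)) (subst (λ t → branch h′ (zero , t)) (sym eq) (proj₂ (centre h′∈)))

  good : GridEdge k → Bool
  good e = unmarked (from e) ∧ unmarked (to e)

  good-edges-bound : count unmarked gridVertices ≡ 0 ⊎ count good gridEdges < count unmarked gridVertices
  good-edges-bound = forest-bound good-edge-bridge (filterᵇ good gridEdges)
    (Unique.filter⁺ (T? ∘ good) gridEdges-unique) (All.map (Equivalence.to T-∧) (All.all-filter (T? ∘ good) gridEdges))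

  grid-side-bound : k * k ≤ 3 * n
  grid-side-bound = ≤-trans
    (square-bound k (count good gridEdges) (count marked gridVertices) (count unmarked gridVertices)
      (grid-edge-bound marked) good-edges-bound
      (trans (count-not marked gridVertices) (length-tabulate² {p = suc k} {suc k} _,_)))
    (*-monoʳ-≤ 3 marked-bound)

theorem11 : (m n : ℕ) (R : Fin n → Fin n → Set) → IsTree (FinGraph n R) →
    (a b c : ℕ) →
    IsGM (Star m □ FinGraph n R) a →
    IsGM (Star m ⊠ FinGraph n R) b →
    IsGM (Star m · FinGraph n R) c →
    a ≤ b × b ≤ c × (c ∸ 1) ^ 2 < 3 * n + 1
theorem11 m n R tree@((_ , T-loopless) , _) a b c gm-□ gm-⊠ gm-· =
  IsGM-mono (□⊆⊠ (star-loopless m) T-loopless) gm-□ gm-⊠ ,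
  IsGM-mono (⊠⊆· {Star m} {FinGraph n R}) gm-⊠ gm-· ,
  side-bound c (proj₁ gm-·)
  where
  side-bound : ∀ c → Grid c ≼ (Star m · FinGraph n R) → (c ∸ 1) ^ 2 < 3 * n + 1
  side-bound zero    _     = m≤n+m 1 (3 * n)
  side-bound (suc k) model = begin-strict
    k * (k * 1)   ≡⟨ cong (k *_) (*-identityʳ k) ⟩
    k * k         ≤⟨ GridModelInLexProduct.grid-side-bound m n R tree k model ⟩
    3 * n         <⟨ m<m+n (3 * n) z<s ⟩
    3 * n + 1     ∎
    where open ≤-Reasoning
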